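{- Let $p(\bar{x})=\{\varphi(\bar{x},\bar{a}_\beta):\beta<\lambda\}$ be a graph-like $\lambda$-type of $\widehat{\mathcal{M}}=\prod_{\alpha<\lambda}\mathcal{M}_\alpha/\mathcal{D}$, with representatives witnessing that it is graph-like and Łoś map $L$ with respect to them. Then $p(\bar{x})$ is realized in $\widehat{\mathcal{M}}$ if and only if $\eta_L[\lambda]\subseteq A$ for some internal subset $A$ of $\mathbb{G}_L$ that induces a complete subgraph of $\mathbb{G}_L$.
   Context: $\lambda$ is an infinite cardinal, $\mathcal{D}$ a regular ultrafilter on $\lambda$, $(\mathcal{M}_\alpha)_{\alpha<\lambda}$ structures in a common language; $\mathcal{P}_\omega(\lambda)$ the finite subsets of $\lambda$, $[X]^2$ the 2-element subsets. Given representatives $\bar r_\beta\in\prod_\alpha\mathcal{M}_\alpha$ of the $\bar a_\beta$, the Łoś map is $L(\Delta)=\{\alpha<\lambda:\mathcal{M}_\alpha\models\exists\bar{x}\bigwedge_{\beta\in\Delta}\varphi(\bar{x},\bar{r}_\beta(\alpha))\}$ ($p$ being a type means $L(\Delta)\in\mathcal{D}$ for all $\Delta$). $p$ is graph-like if representatives can be chosen so that $L(\Delta)=\bigcap_{\Phi\in[\Delta]^2}L(\Phi)$ for all $\Delta$ with $|\Delta|\ge2$. Let $k_1(\alpha)=\{\beta:\alpha\in L(\{\beta\})\}$, $k_2(\alpha)=\{\{\beta,\gamma\}\in[\lambda]^2:\alpha\in L(\{\beta,\gamma\})\}$, $\mathrm{ess}(L)=\{\alpha:k_1(\alpha)\ne\emptyset\}$,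 $\mathcal{D}'=\{B\cap\mathrm{ess}(L):B\in\mathcal{D}\}$. The Łoś ultragraph is $\mathbb{G}_L=\prod_{\alpha\in\mathrm{ess}(L)}(k_1(\alpha),k_2(\alpha))/\mathcal{D}'$ (vertex set $k_1(\alpha)$, edge set $k_2(\alpha)$). For $\beta<\lambda$, $\eta_L(\beta)$ is the $\mathcal{D}'$-class of any $s\in\prod_{\alpha\in\mathrm{ess}(L)}k_1(\alpha)$ with $s(\alpha)=\beta$ whenever $\beta\in k_1(\alpha)$. A subset of $\mathbb{G}_L$ is internal if of the form $\prod_{\alpha\in\mathrm{ess}(L)}A_\alpha/\mathcal{D}'$ with $A_\alpha\subseteq k_1(\alpha)$. -}

module Defs where

open import Data.Nat using (ℕ)
open import Data.Fin using (Fin)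
open import Data.Unit using (⊤)
open import Data.Empty using (⊥)
open import Data.List using (List; []; _∷_)
open import Data.List.Membership.Propositional using (_∈_)
open import Data.Product using (Σ; ∃; _×_; _,_)
open import Data.Sum using (_⊎_)
open import Relation.Nullary using (¬_)
open import Relation.Binary.PropositionalEquality using (_≡_; _≢_)
open import Function.Definitions using (Injective)

Subset : Set → Set₁
Subset Λ = Λ → Set

Infinite : Set → Set
Infinite Λ = Σ (ℕ → Λ) (λ f → Injective _≡_ _≡_ f)

record IsUltrafilter {Λ : Set} (D : Subset Λ → Set) : Set₁ where
  field
    full   : D (λ _ → ⊤)
    proper : ¬ D (λ _ → ⊥)
    upward : ∀ {X Y : Subset Λ} → (∀ α → X α → Y α) → D X → D Y
    inter  : ∀ {X Y : Subset Λ} → D X → D Y → D (λ α → X α × Y α)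
    ultra  : ∀ (X : Subset Λ) → D X ⊎ D (λ α → ¬ X α)

IsFinite : {Λ : Set} → Subset Λ → Set
IsFinite {Λ} X = Σ (List Λ) (λ xs → ∀ i → X i → i ∈ xs)

IsRegular : {Λ : Set} → (Subset Λ → Set) → Set₁
IsRegular {Λ} D =
  Σ (Λ → Subset Λ) (λ E → (∀ i → D (E i)) × (∀ α → IsFinite (λ i → E i α)))

-- The setting of the type p(x̄) = {φ(x̄, ā_β) : β ∈ Λ}.
--   M α          : universe of the structure M_α
--   n, m         : lengths of the tuples x̄ and ā_β
--   Φ α          : interpretation of φ(x̄, ȳ) in M_α
--   r β          : a representative r̄_β ∈ ∏_α M_α^m of ā_β

module Setting {Λ : Set} (M : Λ → Set) {n m : ℕ}
  (Φ : (α : Λ) → (Fin n → M α) → (Fin m → M α) → Set)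
  (r : Λ → (α : Λ) → Fin m → M α) where

  Los : List Λ → Subset Λ
  Los Δ α = Σ (Fin n → M α) (λ x → ∀ β → β ∈ Δ → Φ α x (r β α))

  IsType : (Subset Λ → Set) → Set
  IsType D = ∀ (Δ : List Λ) → D (Los Δ)

  -- The representatives witness that p is graph-like:
  -- for |Δ| ≥ 2,  L(Δ) = ⋂_{Φ ∈ [Δ]²} L(Φ)
  -- (the inclusion ⊆ is automatic; we state ⊇).
  GraphLike : Set
  GraphLike = ∀ (Δ : List Λ) →
    (Σ Λ λ β → Σ Λ λ γ → β ∈ Δ × γ ∈ Δ × β ≢ γ) →
    ∀ α → (∀ β γ → β ∈ Δ → γ ∈ Δ → β ≢ γ → Los (β ∷ γ ∷ []) α) →
    Los Δ α

  -- p(x̄) is realized in the ultraproduct ∏ M_α / D: some b̄ ∈ ∏_α M_α^n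
  -- satisfies φ(b̄, ā_β) for every β (by definition of satisfaction of
  -- the relation φ in the ultraproduct, i.e. Łoś).
  Realized : (Subset Λ → Set) → Set
  Realized D = Σ ((α : Λ) → Fin n → M α) λ b →
    ∀ β → D (λ α → Φ α (b α) (r β α))

module Ultragraph {Λ : Set} (D : Subset Λ → Set) (L : List Λ → Subset Λ) where

  k₁ : Λ → Subset Λ
  k₁ α β = L (β ∷ []) α

  k₂ : Λ → Λ → Λ → Set
  k₂ α β γ = β ≢ γ × L (β ∷ γ ∷ []) α

  ess : Subset Λ
  ess α = Σ Λ (k₁ α)

  -- Membership of X ∩ ess(L) in D' = {B ∩ ess(L) : B ∈ D}.
  D′ : Subset Λ → Set₁
  D′ X = Σ (Subset Λ) λ B → D B × (∀ α → ess α → (X α → B α) × (B α → X α))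

  -- Vertices of G_L: elements of ∏_{α ∈ ess(L)} k₁(α), represented by
  -- functions s : Λ → Λ (values outside ess(L) are irrelevant).
  Vertex : Set
  Vertex = Σ (Λ → Λ) λ s → ∀ α → ess α → k₁ α (s α)

  vert : Vertex → Λ → Λ
  vert (s , _) = s

  _≈_ : Vertex → Vertex → Set₁
  s ≈ t = D′ (λ α → vert s α ≡ vert t α)

  Edge : Vertex → Vertex → Set₁
  Edge s t = D′ (λ α → k₂ α (vert s α) (vert t α))

  IsEta : Λ → Vertex → Set
  IsEta β s = ∀ α → ess α → k₁ α β → vert s α ≡ β

  -- internal subsets ∏_{α ∈ ess(L)} A_α / D' with A_α ⊆ k₁(α)
  IsInternalFamily : (Λ → Subset Λ) → Set
  IsInternalFamily A = ∀ α → ess α → ∀ β → A α β → k₁ α β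

  _∈ᴵ_ : Vertex → (Λ → Subset Λ) → Set₁
  s ∈ᴵ A = D′ (λ α → A α (vert s α))

  InducesComplete : (Λ → Subset Λ) → Set₁
  InducesComplete A = ∀ s t → s ∈ᴵ A → t ∈ᴵ A → ¬ (s ≈ t) → Edge s t

  EtaImageIn : (Λ → Subset Λ) → Set₁
  EtaImageIn A = ∀ β s → IsEta β s → s ∈ᴵ A

{-# OPTIONS --safe #-}
module Submission where

open import Defs
open import Level using (0ℓ)
open import Data.Nat using (ℕ)
open import Data.Fin using (Fin)
open import Data.Product using (Σ; _×_; _,_; proj₁; proj₂)
open import Data.Sum using (inj₁; inj₂)
open import Data.Empty using (⊥; ⊥-elim)
open import Data.List using (List; []; _∷_; filter)
open import Data.List.Membership.Propositional using (_∈_)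
open import Data.List.Membership.Propositional.Properties using (∈-filter⁺; ∈-filter⁻)
open import Data.List.Relation.Unary.Any using (here; there)
open import Relation.Nullary using (¬_; yes; no)
open import Relation.Nullary.Decidable using (decidable-stable)
open import Relation.Binary.PropositionalEquality using (_≡_; _≢_; refl; sym; subst)
open import Function using (id)
open import Function.Bundles using (_⇔_; mk⇔)
open import Axiom.ExcludedMiddle using (ExcludedMiddle)

-- If p is realized by b̄, the sets A_α = {β : M_α ⊨ φ(b̄(α), r̄_β(α))} form an
-- internal set containing η_L[λ] on which any two distinct vertices are
-- joined, since b̄(α) witnesses α ∈ L({β, γ}).
--
-- Conversely, completeness of A forces A_α to be a clique of (k₁(α), k₂(α))
-- for D-almost all α: otherwise choosing a non-edge of A_α on a D-large set
-- gives two distinct vertices of A that are not adjacent.  By regularity, α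
-- lies in only finitely many of the sets E_β ∈ D; graph-likeness turns the
-- clique A_α ∩ {β : α ∈ E_β} into a single point b̄(α) satisfying all of its
-- formulas, and η_L(β) ∈ A puts β into that finite set for D-almost all α.

module Choice (em : ExcludedMiddle 0ℓ) where

  ε : {A : Set} → (A → Set) → A → A
  ε {A} P a with em {Σ A P}
  ... | yes (x , _) = x
  ... | no _ = a

  ε-elim : {A : Set} (P : A → Set) (a : A) (R : A → Set) →
    (∀ x → P x → R x) → R a → R (ε P a)
  ε-elim {A} P a R P⇒R Ra with em {Σ A P}
  ... | yes (x , Px) = P⇒R x Px
  ... | no _ = Ra

  ε-spec : {A : Set} (P : A → Set) (a : A) → Σ A P → P (ε P a)
  ε-spec {A} P a (x , Px) with em {Σ A P}
  ... | yes (_ , Py) = Py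
  ... | no ∄ = ⊥-elim (∄ (x , Px))

module UltrafilterProperties {Λ : Set} {D : Subset Λ → Set} (U : IsUltrafilter D) where
  open IsUltrafilter U

  D-map₂ : {X Y Z : Subset Λ} → (∀ α → X α → Y α → Z α) → D X → D Y → D Z
  D-map₂ f dX dY = upward (λ α (x , y) → f α x y) (inter dX dY)

  D-disjoint : {X Y : Subset Λ} → D X → D Y → (∀ α → X α → Y α → ⊥) → ⊥
  D-disjoint dX dY f = proper (D-map₂ f dX dY)

  ¬D⇒D∁ : {X : Subset Λ} → ¬ D X → D (λ α → ¬ X α)
  ¬D⇒D∁ {X} ¬dX with ultra X
  ... | inj₁ dX = ⊥-elim (¬dX dX)
  ... | inj₂ d∁ = d∁

  ¬D∁⇒D : {X : Subset Λ} → ¬ D (λ α → ¬ X α) → D X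
  ¬D∁⇒D {X} ¬d∁ with ultra X
  ... | inj₁ dX = dX
  ... | inj₂ d∁ = ⊥-elim (¬d∁ d∁)

module GraphLikeType {Λ : Set} (M : Λ → Set) {n m : ℕ}
  (Φ : (α : Λ) → (Fin n → M α) → (Fin m → M α) → Set)
  (r : Λ → (α : Λ) → Fin m → M α) where
  open Setting M Φ r

  Los-single : ∀ {α β} x → Φ α x (r β α) → Los (β ∷ []) α
  Los-single x Φβ = x , λ { _ (here refl) → Φβ }

  Los-pair : ∀ {α β γ} x → Φ α x (r β α) → Φ α x (r γ α) → Los (β ∷ γ ∷ []) α
  Los-pair x Φβ Φγ = x , λ { _ (here refl) → Φβ ; _ (there (here refl)) → Φγ }

  PairwiseConsistent : Subset Λ → Λ → Set
  PairwiseConsistent X α = ∀ β γ → X β → X γ → β ≢ γ → Los (β ∷ γ ∷ []) α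

  module _ (em : ExcludedMiddle 0ℓ) (gl : GraphLike) where
    open Choice em

    Los-of-pairwise : ∀ {Δ α β} → β ∈ Δ → Los (β ∷ []) α →
      PairwiseConsistent (_∈ Δ) α → Los Δ α
    Los-of-pairwise {Δ} {α} {β} β∈Δ (x , Φβ) pc
      with em {Σ Λ λ β → Σ Λ λ γ → β ∈ Δ × γ ∈ Δ × β ≢ γ}
    ... | yes two = gl Δ two α pc
    ... | no ¬two = x , λ γ γ∈Δ → subst (λ δ → Φ α x (r δ α)) (sym (γ≡β γ∈Δ)) (Φβ β (here refl))
      where
      γ≡β : ∀ {γ} → γ ∈ Δ → γ ≡ β
      γ≡β {γ} γ∈Δ = decidable-stable em λ γ≢β → ¬two (γ , β , γ∈Δ , β∈Δ , γ≢β)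

    realized-of-pairwise-consistent : {D : Subset Λ → Set} → IsUltrafilter D → IsRegular D →
      ((α : Λ) → M α) → IsType D → (A : Λ → Subset Λ) →
      D (λ α → PairwiseConsistent (A α) α) → (∀ β → D (λ α → A α β)) → Realized D
    realized-of-pairwise-consistent {D} U (E , E∈D , E-finite) m₀ ty A pc-ae A-ae = b , b-sat
      where
      open IsUltrafilter U

      Δ : Λ → List Λ
      Δ α = filter (λ β → em {A α β}) (proj₁ (E-finite α))

      b : (α : Λ) → Fin n → M α
      b α = ε (λ x → ∀ γ → γ ∈ Δ α → Φ α x (r γ α)) (λ _ → m₀ α)

      b-sat-at : ∀ {α β} → E β α → A α β → PairwiseConsistent (A α) α →
        Los (β ∷ []) α → Φ α (b α) (r β α)
      b-sat-at {α} {β} eβ aβ pc lβ = ε-spec _ _ (Los-of-pairwise β∈Δ lβ pcΔ) β β∈Δ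
        where
        β∈Δ : β ∈ Δ α
        β∈Δ = ∈-filter⁺ (λ β → em {A α β}) (proj₂ (E-finite α) β eβ) aβ
        A-of : ∀ {γ} → γ ∈ Δ α → A α γ
        A-of γ∈Δ = proj₂ (∈-filter⁻ (λ β → em {A α β}) {xs = proj₁ (E-finite α)} γ∈Δ)
        pcΔ : PairwiseConsistent (_∈ Δ α) α
        pcΔ γ δ γ∈Δ δ∈Δ = pc γ δ (A-of γ∈Δ) (A-of δ∈Δ)

      b-sat : ∀ β → D (λ α → Φ α (b α) (r β α))
      b-sat β = upward (λ α (eβ , aβ , pc , lβ) → b-sat-at eβ aβ pc lβ)
        (inter (E∈D β) (inter (A-ae β) (inter pc-ae (ty (β ∷ [])))))

module LosUltragraph (em : ExcludedMiddle 0ℓ) {Λ : Set} (λ₀ : Λ)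
  {D : Subset Λ → Set} (U : IsUltrafilter D)
  (M : Λ → Set) {n m : ℕ} (Φ : (α : Λ) → (Fin n → M α) → (Fin m → M α) → Set)
  (r : Λ → (α : Λ) → Fin m → M α) (ty : Setting.IsType M Φ r D) where
  open IsUltrafilter U
  open UltrafilterProperties U
  open Choice em
  open Setting M Φ r
  open GraphLikeType M Φ r
  open Ultragraph D Los

  ess∈D : D ess
  ess∈D = upward (λ α l → λ₀ , l) (ty (λ₀ ∷ []))

  D′⇒D : {X : Subset Λ} → D′ X → D X
  D′⇒D (B , B∈D , X⇔B) = D-map₂ (λ α Bα e → proj₂ (X⇔B α e) Bα) B∈D ess∈D

  D⇒D′ : {X : Subset Λ} → D X → D′ X
  D⇒D′ {X} X∈D = X , X∈D , λ _ _ → id , id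

  realized⇒complete-internal : Realized D →
    Σ (Λ → Subset Λ) λ A → IsInternalFamily A × InducesComplete A × EtaImageIn A
  realized⇒complete-internal (b , b-sat) = A , internal , complete , eta-in
    where
    A : Λ → Subset Λ
    A α β = Φ α (b α) (r β α)

    internal : IsInternalFamily A
    internal α _ β = Los-single (b α)

    complete : InducesComplete A
    complete s t s∈A t∈A s≉t = D⇒D′ (D-map₂ (λ α (as , at) s≢t → s≢t , Los-pair (b α) as at)
      (D-map₂ (λ _ → _,_) (D′⇒D s∈A) (D′⇒D t∈A)) (¬D⇒D∁ (λ s≡t → s≉t (D⇒D′ s≡t))))

    eta-in : EtaImageIn A
    eta-in β s isη = D⇒D′ (upward (λ α aβ → let kβ = Los-single (b α) aβ in
      subst (A α) (sym (isη α (β , kβ) kβ)) aβ) (b-sat β))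

  some-vertex : Λ → Λ
  some-vertex α = ε (k₁ α) λ₀

  choose : (Q : Λ → Λ → Set) → (∀ {α β} → ess α → Q α β → k₁ α β) → Vertex
  choose Q Q⇒k₁ = (λ α → ε (Q α) (some-vertex α)) ,
    λ α e → ε-elim (Q α) (some-vertex α) (k₁ α) (λ _ → Q⇒k₁ e) (ε-spec (k₁ α) λ₀ e)

  choose-spec : (Q : Λ → Λ → Set) (Q⇒k₁ : ∀ {α β} → ess α → Q α β → k₁ α β) →
    ∀ α → Σ Λ (Q α) → Q α (vert (choose Q Q⇒k₁) α)
  choose-spec Q _ α = ε-spec (Q α) (some-vertex α)

  IsVertexAt : Λ → Λ → Λ → Set
  IsVertexAt β α γ = γ ≡ β × k₁ α γ

  eta : Λ → Vertex
  eta β = choose (IsVertexAt β) (λ _ → proj₂)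

  eta-isEta : ∀ β → IsEta β (eta β)
  eta-isEta β α _ kβ = proj₁ (choose-spec (IsVertexAt β) (λ _ → proj₂) α (β , refl , kβ))

  EtaImageIn⇒ae : ∀ {A} → EtaImageIn A → ∀ β → D (λ α → A α β)
  EtaImageIn⇒ae {A} η∈A β = D-map₂ (λ α aη kβ → subst (A α) (eta-isEta β α (β , kβ) kβ) aη)
    (D′⇒D (η∈A β (eta β) (eta-isEta β))) (ty (β ∷ []))

  module _ {A : Λ → Subset Λ} (internal : IsInternalFamily A) where

    record NonEdge (α β γ : Λ) : Set where
      field
        inA₁ : A α β
        inA₂ : A α γ
        distinct : β ≢ γ
        inconsistent : ¬ Los (β ∷ γ ∷ []) α
    open NonEdge

    nonEdge-of-¬pairwise : ∀ {α} → ¬ PairwiseConsistent (A α) α → Σ Λ λ β → Σ Λ (NonEdge α β)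
    nonEdge-of-¬pairwise {α} ¬pc = decidable-stable em λ ∄ →
      ¬pc λ β γ aβ aγ β≢γ → decidable-stable em λ ¬l → ∄ (β , γ , record
        { inA₁ = aβ ; inA₂ = aγ ; distinct = β≢γ ; inconsistent = ¬l })

    StartsNonEdge : Λ → Λ → Set
    StartsNonEdge α β = Σ Λ (NonEdge α β)

    startsNonEdge⇒k₁ : ∀ {α β} → ess α → StartsNonEdge α β → k₁ α β
    startsNonEdge⇒k₁ e (_ , ne) = internal _ e _ (inA₁ ne)

    -- A non-edge (s(α), t(α)) of A_α, chosen wherever one exists.
    s : Vertex
    s = choose StartsNonEdge startsNonEdge⇒k₁

    EndsNonEdge : Λ → Λ → Set
    EndsNonEdge α γ = NonEdge α (vert s α) γ

    endsNonEdge⇒k₁ : ∀ {α γ} → ess α → EndsNonEdge α γ → k₁ α γ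
    endsNonEdge⇒k₁ e ne = internal _ e _ (inA₂ ne)

    t : Vertex
    t = choose EndsNonEdge endsNonEdge⇒k₁

    nonEdge-at : ∀ {α} → ¬ PairwiseConsistent (A α) α → NonEdge α (vert s α) (vert t α)
    nonEdge-at {α} ¬pc = choose-spec EndsNonEdge endsNonEdge⇒k₁ α
      (choose-spec StartsNonEdge startsNonEdge⇒k₁ α (nonEdge-of-¬pairwise ¬pc))

    InducesComplete⇒pairwise-ae : InducesComplete A → D (λ α → PairwiseConsistent (A α) α)
    InducesComplete⇒pairwise-ae complete = ¬D∁⇒D λ ¬pc-ae →
      let s∈A = D⇒D′ (upward (λ α ¬pc → inA₁ (nonEdge-at ¬pc)) ¬pc-ae)
          t∈A = D⇒D′ (upward (λ α ¬pc → inA₂ (nonEdge-at ¬pc)) ¬pc-ae)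
          s≉t = λ s≈t → D-disjoint ¬pc-ae (D′⇒D s≈t) λ α ¬pc → distinct (nonEdge-at ¬pc)
      in D-disjoint ¬pc-ae (D′⇒D (complete s t s∈A t∈A s≉t))
           λ α ¬pc edge → inconsistent (nonEdge-at ¬pc) (proj₂ edge)

theorem6p14 : ExcludedMiddle 0ℓ →
    {Λ : Set} → Infinite Λ →
    (D : Subset Λ → Set) → IsUltrafilter D → IsRegular D →
    (M : Λ → Set) → ((α : Λ) → M α) →
    {n m : ℕ} → (Φ : (α : Λ) → (Fin n → M α) → (Fin m → M α) → Set) →
    (r : Λ → (α : Λ) → Fin m → M α) →
    Setting.IsType M Φ r D → Setting.GraphLike M Φ r →
    Setting.Realized M Φ r D ⇔
      Σ (Λ → Subset Λ) (λ A →
        Ultragraph.IsInternalFamily D (Setting.Los M Φ r) A ×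
        Ultragraph.InducesComplete D (Setting.Los M Φ r) A ×
        Ultragraph.EtaImageIn D (Setting.Los M Φ r) A)
theorem6p14 em (enum , _) D U R M m₀ Φ r ty gl =
  mk⇔ realized⇒complete-internal
      λ (A , internal , complete , η∈A) →
        realized-of-pairwise-consistent em gl U R m₀ ty A
          (InducesComplete⇒pairwise-ae internal complete) (EtaImageIn⇒ae η∈A)
  where
  open GraphLikeType M Φ r
  open LosUltragraph em (enum 0) U M Φ r ty
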